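{- Let $G$ be a tree with root $r$ and $p(r)=0$, and consider an execution of the density-greedy algorithm for trees on $G$. Suppose that in some iteration, with current contracted tree $\overline T$, the algorithm chooses the min-max subtree $T^*$ of $G/\overline T$, and let $T^+$ be its extension in $G$, with $\ell=|E(T^+)|$ edges. Let $e_1,\dots,e_\ell$ be the edges appended to $\pi$ in this and the next $\ell-1$ iterations, and for $i\in\{1,\dots,\ell\}$ let $T_i^+$ be the extension in $G$ of the min-max subtree chosen in the iteration in which $e_i$ is appended (so $T_1^+=T^+$). Then $T_i^+\subseteq T^+$ and $d_G(T_i^+)>d_G(T^+)$ for all $i\in\{2,\dots,\ell\}$ (in particular $\{e_1,\dots,e_\ell\}=E(T^+)$).
   Context: $G=(V,E)$ is a tree with edge costs $c(e)>0$, prizes $p(v)\ge0$, root $r$. For a subgraph $S$, $p(S)$ and $c(S)$ are the sums of its vertex prizes and edge costs. Rooted subtree: subtree containing $r$; density $d(T)=p(T)/c(T)$ (trivial tree: $0$). A min-max subtree is an inclusion-wise minimal rooted subtree of maximum density. For a rooted subtree $\overline T$, $G/\overline T$ is obtained by contracting all edges of $\overline T$ into $r$; each of its edges corresponds to a unique edge of $G$ not in $\overline T$; prizes unchanged except the root gets $0$. The extension of a subgraph $C$ of $G/\overline T$ is the subgraph of $G$ formed by the edges of $G$ corresponding to edges of $C$. For a subtree $S$ of $G$ with at least one edge, $r_S$ is its vertex closest to $r$ and $d_G(S)=(p(S)-p(r_S))/c(S)$. Density-greedy algorithm for trees: $\pi=()$, $\overline T=(\{r\},\emptyset)$; while $G/\overline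 T$ has nonzero total prize: choose an arbitrary min-max subtree of $G/\overline T$, append to $\pi$ the edge of $G$ corresponding to its unique edge incident to $r$, and add that edge to $\overline T$; output $\pi$.
   Formalization: The edge costs $c(e)$ and the prizes $p(v)$ are rational numbers instead of real numbers. -}

module Defs where

open import Data.Nat as ℕ using (ℕ; zero; suc)
open import Data.Fin using (Fin; zero; suc; toℕ)
open import Data.Fin.Subset using (Subset; _∈_; _∉_; _⊆_; _∪_; ⁅_⁆; ∁; ∣_∣)
  renaming (⊥ to ∅)
open import Data.Vec using (_∷_; [])
open import Data.Bool using (true; false)
open import Data.Rational using (ℚ; 0ℚ; _+_; _÷_; _<_; _≤_; _≟_; ≢-nonZero)
open import Data.Product using (Σ; ∃; _×_; _,_)
open import Data.Sum using (_⊎_)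
open import Relation.Nullary using (yes; no; ¬_)
open import Relation.Binary.PropositionalEquality using (_≡_; _≢_)

-- Vertices are  Fin (suc n) , the root r is vertex  zero .  Every
-- non-root vertex  suc i  has a parent  parent i  with a smaller index
-- (every finite rooted tree admits such a labelling, e.g. BFS order).
-- The edges are  Fin n : edge  i  joins vertex  suc i  (its lower
-- endpoint) to vertex  parent i  (its upper endpoint).

record Tree (n : ℕ) : Set where
  field
    parent    : Fin n → Fin (suc n)
    parent<   : ∀ i → toℕ (parent i) ℕ.≤ toℕ i   -- i.e. parent i < suc i
    cost      : Fin n → ℚ
    cost-pos  : ∀ i → 0ℚ < cost i
    prize     : Fin (suc n) → ℚ
    prize-nn  : ∀ v → 0ℚ ≤ prize v

open Tree public

-- Subgraphs are given by their edge sets  Subset n .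

sumOver : ∀ {n} → Subset n → (Fin n → ℚ) → ℚ
sumOver []            f = 0ℚ
sumOver (true  ∷ s)   f = f zero + sumOver s (λ i → f (suc i))
sumOver (false ∷ s)   f = sumOver s (λ i → f (suc i))

-- x / y, with the convention x / 0 = 0 (used for the trivial tree).
_÷₀_ : ℚ → ℚ → ℚ
x ÷₀ y with y ≟ 0ℚ
... | yes _  = 0ℚ
... | no y≢0 = _÷_ x y {{≢-nonZero y≢0}}

module _ {n : ℕ} (G : Tree n) where

  ParentEdge : Fin n → Fin n → Set
  ParentEdge i j = parent G i ≡ suc j

  costOf : Subset n → ℚ
  costOf S = sumOver S (cost G)

  lowerPrize : Subset n → ℚ
  lowerPrize S = sumOver S (λ i → prize G (suc i))

  -- Rooted subtrees of G (edge sets closed under taking parent edges;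
  -- vertex set = r together with the lower endpoints of the edges).
  RootedSubtree : Subset n → Set
  RootedSubtree S = ∀ i j → i ∈ S → ParentEdge i j → j ∈ S

  -- The contracted tree  G / Tbar  (Tbar a rooted subtree of G).
  -- Its edges are the edges of G not in Tbar; a subgraph of  G / Tbar
  -- is identified with its extension in G (an edge set disjoint from
  -- Tbar).  In G/Tbar an edge  i  is incident to the root iff its upper
  -- endpoint is a vertex of Tbar (r, or the lower endpoint of an edge of
  -- Tbar); the parent edge of  i  in G/Tbar is its parent edge in G
  -- otherwise.  All vertices of Tbar are merged into the root, whose
  -- prize is 0; other prizes are unchanged.

  RootedSubtreeC : Subset n → Subset n → Set
  RootedSubtreeC Tbar S =
    (∀ i → i ∈ S → i ∉ Tbar) ×
    (∀ i j → i ∈ S → ParentEdge i j → j ∈ S ⊎ j ∈ Tbar)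

  -- p_{G/Tbar}(C) = p(root) + prizes of lower endpoints = 0 + lowerPrize S.
  prizeC : Subset n → ℚ
  prizeC S = 0ℚ + lowerPrize S

  densityC : Subset n → ℚ
  densityC S = prizeC S ÷₀ costOf S

  MinMax : Subset n → Subset n → Set
  MinMax Tbar S =
    RootedSubtreeC Tbar S ×
    (∀ S' → RootedSubtreeC Tbar S' → densityC S' ≤ densityC S) ×
    (∀ S' → RootedSubtreeC Tbar S' → S' ⊆ S → densityC S' ≡ densityC S → S' ≡ S)

  RootEdge : Subset n → Subset n → Fin n → Set
  RootEdge Tbar S e =
    e ∈ S × (parent G e ≡ zero ⊎ Σ (Fin n) (λ j → ParentEdge e j × j ∈ Tbar))

  -- Total prize of G/Tbar: root has prize 0, the other vertices are the
  -- lower endpoints of the edges not in Tbar.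
  totalPrizeC : Subset n → ℚ
  totalPrizeC Tbar = 0ℚ + lowerPrize (∁ Tbar)

  -- d_G(S) = (p(S) - p(r_S)) / c(S) for a subtree S of G with ≥ 1 edge.
  -- The vertex set of such an S is r_S together with the (distinct)
  -- lower endpoints of its edges, so p(S) - p(r_S) = lowerPrize S.
  dG : Subset n → ℚ
  dG S = lowerPrize S ÷₀ costOf S

  -- Iteration k (k < m) starts with contracted tree Tbar k,
  -- chooses the min-max subtree of G/Tbar k with extension chosen k,
  -- appends e k (its edge incident to the root) to π, and sets
  -- Tbar (k+1) = Tbar k ∪ {e k}.
  record Execution (m : ℕ) : Set where
    field
      Tbar     : ℕ → Subset n
      chosen   : ℕ → Subset n
      e        : ℕ → Fin n
      start    : Tbar 0 ≡ ∅
      running  : ∀ k → k ℕ.< m → totalPrizeC (Tbar k) ≢ 0ℚ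
      minmax   : ∀ k → k ℕ.< m → MinMax (Tbar k) (chosen k)
      rootEdge : ∀ k → k ℕ.< m → RootEdge (Tbar k) (chosen k) (e k)
      step     : ∀ k → k ℕ.< m → Tbar (suc k) ≡ Tbar k ∪ ⁅ e k ⁆
      stop     : totalPrizeC (Tbar m) ≡ 0ℚ

  open Execution public

{-# OPTIONS --safe #-}
-- Let T* be the min-max subtree of G/T̄ and d* its density, and let T̄′ ⊇ T̄ be a
-- later contracted tree that contains some but not all edges of T*.  By
-- minimality of T*, the part T* ∩ T̄′ is strictly sparser than d*, so the rest
-- T* ─ T̄′, a rooted subtree of G/T̄′, is strictly denser than d*.  In particular
-- G/T̄′ still has positive prize and its min-max subtree S is denser than d*.
-- If S left T*, maximality of T* (tested on T* ∪ S) makes S ─ T* no denser than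
-- d* < d(S), so S ∩ T* would be denser than S, contradicting maximality of S.
-- Hence every later choice lies inside T*, and the ℓ = |T*| iterations starting
-- with T* append exactly the edges of T*.
module Submission where

open import Defs
open import Data.Nat using (ℕ; zero; suc)
open import Data.Fin using (Fin; zero; suc)
open import Data.Fin.Properties using (0≢1+n; suc-injective)
open import Data.Fin.Subset
  using (Subset; inside; outside; _∈_; _∉_; _⊆_; _∪_; _∩_; _─_; _-_; ⁅_⁆; ∣_∣; Nonempty)
  renaming (⊥ to ∅)
open import Data.Fin.Subset.Properties
  using ( drop-there; drop-∷-⊆; nonempty?; Empty-unique; ∉⊥; x∈⁅x⁆; x∈⁅y⁆⇒x≡y
        ; x∈p∪q⁻; x∈p∪q⁺; x∈p∩q⁻; x∈p∩q⁺; p∩q⊆p; p─q⊆p; x∈p∧x∉q⇒x∈p─q; x∉p⇒x∈∁p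
        ; p─⊥≡p; p─q─r≡p─q∪r; _∈?_; x∈p⇒∣p-x∣<∣p∣; ∣⊥∣≡0 )
open import Data.Vec using (_∷_; []; here; there)
open import Data.Product using (Σ; _×_; _,_; proj₁; proj₂)
open import Data.Sum using (_⊎_; inj₁; inj₂; [_,_]′; map; map₁; map₂; swap)
open import Function using (_∘_)
open import Relation.Nullary using (yes; no; ¬_; contradiction)
open import Relation.Binary.PropositionalEquality

x∈p─q⇒x∉q : ∀ {n} {p q : Subset n} {x} → x ∈ p ─ q → x ∉ q
x∈p─q⇒x∉q {p = _ ∷ p} {outside ∷ q} here        = λ ()
x∈p─q⇒x∉q {p = _ ∷ p} {_       ∷ q} (there x∈) = x∈p─q⇒x∉q x∈ ∘ drop-there

p─q≡p : ∀ {n} {p q : Subset n} → (∀ x → x ∈ p → x ∉ q) → p ─ q ≡ p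
p─q≡p {p = []}          {[]}          _        = refl
p─q≡p {p = inside  ∷ p} {inside  ∷ q} disjoint = contradiction here (disjoint zero here)
p─q≡p {p = inside  ∷ p} {outside ∷ q} disjoint =
  cong (inside ∷_) (p─q≡p λ x x∈p → disjoint (suc x) (there x∈p) ∘ there)
p─q≡p {p = outside ∷ p} {inside  ∷ q} disjoint =
  cong (outside ∷_) (p─q≡p λ x x∈p → disjoint (suc x) (there x∈p) ∘ there)
p─q≡p {p = outside ∷ p} {outside ∷ q} disjoint =
  cong (outside ∷_) (p─q≡p λ x x∈p → disjoint (suc x) (there x∈p) ∘ there)

x∈p⇒suc∣p-x∣≡∣p∣ : ∀ {n} {p : Subset n} {x} → x ∈ p → suc ∣ p - x ∣ ≡ ∣ p ∣
x∈p⇒suc∣p-x∣≡∣p∣ {p = inside  ∷ p} here        = cong (suc ∘ ∣_∣) (p─⊥≡p p)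
x∈p⇒suc∣p-x∣≡∣p∣ {p = inside  ∷ p} (there x∈p) = cong suc (x∈p⇒suc∣p-x∣≡∣p∣ x∈p)
x∈p⇒suc∣p-x∣≡∣p∣ {p = outside ∷ p} (there x∈p) = x∈p⇒suc∣p-x∣≡∣p∣ x∈p

module _ {n} (G : Tree n) where

  ∩-rootedSubtreeC : ∀ {T̄ R Q} → RootedSubtreeC G T̄ R → RootedSubtree G Q →
                     RootedSubtreeC G T̄ (R ∩ Q)
  ∩-rootedSubtreeC {T̄} {R} {Q} (R∌ , R-closed) Q-closed = R∩Q∌ , R∩Q-closed
    where
    R∩Q∌ : ∀ i → i ∈ R ∩ Q → i ∉ T̄
    R∩Q∌ i i∈R∩Q = R∌ i (proj₁ (x∈p∩q⁻ R Q i∈R∩Q))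
    R∩Q-closed : ∀ i j → i ∈ R ∩ Q → ParentEdge G i j → j ∈ R ∩ Q ⊎ j ∈ T̄
    R∩Q-closed i j i∈R∩Q i→j with x∈p∩q⁻ R Q i∈R∩Q
    ... | i∈R , i∈Q = map₁ (λ j∈R → x∈p∩q⁺ (j∈R , Q-closed i j i∈Q i→j)) (R-closed i j i∈R i→j)

  ∩-rootedSubtreeC-⊆ : ∀ {T̄ T̄′ S R} → T̄ ⊆ T̄′ → RootedSubtreeC G T̄′ S → RootedSubtreeC G T̄ R →
                       RootedSubtreeC G T̄′ (S ∩ R)
  ∩-rootedSubtreeC-⊆ {T̄} {T̄′} {S} {R} T̄⊆T̄′ (S∌ , S-closed) (_ , R-closed) = S∩R∌ , S∩R-closed
    where
    S∩R∌ : ∀ i → i ∈ S ∩ R → i ∉ T̄′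
    S∩R∌ i i∈S∩R = S∌ i (proj₁ (x∈p∩q⁻ S R i∈S∩R))
    S∩R-closed : ∀ i j → i ∈ S ∩ R → ParentEdge G i j → j ∈ S ∩ R ⊎ j ∈ T̄′
    S∩R-closed i j i∈S∩R i→j with x∈p∩q⁻ S R i∈S∩R
    ... | i∈S , i∈R with S-closed i j i∈S i→j
    ...   | inj₂ j∈T̄′ = inj₂ j∈T̄′
    ...   | inj₁ j∈S   = map (λ j∈R → x∈p∩q⁺ (j∈S , j∈R)) T̄⊆T̄′ (R-closed i j i∈R i→j)

  ─-rootedSubtreeC : ∀ {T̄ T̄′ R} → T̄ ⊆ T̄′ → RootedSubtreeC G T̄ R →
                     RootedSubtreeC G T̄′ (R ─ T̄′)
  ─-rootedSubtreeC {T̄} {T̄′} {R} T̄⊆T̄′ (_ , R-closed) = (λ _ → x∈p─q⇒x∉q) , R─T̄′-closed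
    where
    R─T̄′-closed : ∀ i j → i ∈ R ─ T̄′ → ParentEdge G i j → j ∈ R ─ T̄′ ⊎ j ∈ T̄′
    R─T̄′-closed i j i∈R─T̄′ i→j with R-closed i j (p─q⊆p R T̄′ i∈R─T̄′) i→j
    ... | inj₂ j∈T̄ = inj₂ (T̄⊆T̄′ j∈T̄)
    ... | inj₁ j∈R with j ∈? T̄′
    ...   | yes j∈T̄′ = inj₂ j∈T̄′
    ...   | no  j∉T̄′ = inj₁ (x∈p∧x∉q⇒x∈p─q j∈R j∉T̄′)

  ∪-rootedSubtreeC : ∀ {T̄ T̄′ R S} → T̄ ⊆ T̄′ → T̄′ ⊆ T̄ ∪ R →
                     RootedSubtreeC G T̄ R → RootedSubtreeC G T̄′ S → RootedSubtreeC G T̄ (R ∪ S)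
  ∪-rootedSubtreeC {T̄} {T̄′} {R} {S} T̄⊆T̄′ T̄′⊆T̄∪R (R∌ , R-closed) (S∌ , S-closed) =
    R∪S∌ , R∪S-closed
    where
    R∪S∌ : ∀ i → i ∈ R ∪ S → i ∉ T̄
    R∪S∌ i i∈R∪S with x∈p∪q⁻ R S i∈R∪S
    ... | inj₁ i∈R = R∌ i i∈R
    ... | inj₂ i∈S = S∌ i i∈S ∘ T̄⊆T̄′
    R∪S-closed : ∀ i j → i ∈ R ∪ S → ParentEdge G i j → j ∈ R ∪ S ⊎ j ∈ T̄
    R∪S-closed i j i∈R∪S i→j with x∈p∪q⁻ R S i∈R∪S
    ... | inj₁ i∈R = map₁ (x∈p∪q⁺ ∘ inj₁) (R-closed i j i∈R i→j)
    ... | inj₂ i∈S with S-closed i j i∈S i→j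
    ...   | inj₁ j∈S   = inj₁ (x∈p∪q⁺ (inj₂ j∈S))
    ...   | inj₂ j∈T̄′ = map₁ (x∈p∪q⁺ ∘ inj₁) (swap (x∈p∪q⁻ T̄ R (T̄′⊆T̄∪R j∈T̄′)))

module _ where
  open import Data.Rational
    using (ℚ; 0ℚ; 1ℚ; _+_; _*_; 1/_; _<_; _≤_; ≢-nonZero; NonNegative; positive; nonNegative)
  open import Data.Rational.Properties
  open import Algebra.Bundles using (CommutativeMonoid)
  open import Algebra.Properties.CommutativeSemigroup
    (CommutativeMonoid.commutativeSemigroup +-0-commutativeMonoid) using (x∙yz≈y∙xz)

  sumOver-⊥ : ∀ {n} (f : Fin n → ℚ) → sumOver ∅ f ≡ 0ℚ
  sumOver-⊥ {zero}  f = refl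
  sumOver-⊥ {suc n} f = sumOver-⊥ (f ∘ suc)

  sumOver-nonneg : ∀ {n} (p : Subset n) {f : Fin n → ℚ} → (∀ i → 0ℚ ≤ f i) → 0ℚ ≤ sumOver p f
  sumOver-nonneg []            f≥0 = ≤-refl
  sumOver-nonneg (inside  ∷ p) f≥0 = +-mono-≤ (f≥0 zero) (sumOver-nonneg p (f≥0 ∘ suc))
  sumOver-nonneg (outside ∷ p) f≥0 = sumOver-nonneg p (f≥0 ∘ suc)

  sumOver-pos : ∀ {n} (p : Subset n) {f : Fin n → ℚ} → (∀ i → 0ℚ < f i) → Nonempty p →
                0ℚ < sumOver p f
  sumOver-pos (inside ∷ p) f>0 (zero , here) =
    +-mono-<-≤ (f>0 zero) (sumOver-nonneg p (<⇒≤ ∘ f>0 ∘ suc))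
  sumOver-pos (inside ∷ p) f>0 (suc x , there x∈p) =
    +-mono-≤-< (<⇒≤ (f>0 zero)) (sumOver-pos p (f>0 ∘ suc) (x , x∈p))
  sumOver-pos (outside ∷ p) f>0 (suc x , there x∈p) = sumOver-pos p (f>0 ∘ suc) (x , x∈p)

  sumOver-mono : ∀ {n} {p q : Subset n} {f : Fin n → ℚ} → (∀ i → 0ℚ ≤ f i) → p ⊆ q →
                 sumOver p f ≤ sumOver q f
  sumOver-mono {p = []}          {[]}          f≥0 p⊆q = ≤-refl
  sumOver-mono {p = inside  ∷ p} {inside  ∷ q} {f} f≥0 p⊆q =
    +-monoʳ-≤ (f zero) (sumOver-mono (f≥0 ∘ suc) (drop-∷-⊆ p⊆q))
  sumOver-mono {p = inside  ∷ p} {outside ∷ q} f≥0 p⊆q with () ← p⊆q here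
  sumOver-mono {p = outside ∷ p} {inside  ∷ q} {f} f≥0 p⊆q =
    subst (_≤ sumOver (inside ∷ q) f) (+-identityˡ _)
          (+-mono-≤ (f≥0 zero) (sumOver-mono (f≥0 ∘ suc) (drop-∷-⊆ p⊆q)))
  sumOver-mono {p = outside ∷ p} {outside ∷ q} f≥0 p⊆q = sumOver-mono (f≥0 ∘ suc) (drop-∷-⊆ p⊆q)

  sumOver-∩-─ : ∀ {n} (p q : Subset n) (f : Fin n → ℚ) →
                sumOver p f ≡ sumOver (p ∩ q) f + sumOver (p ─ q) f
  sumOver-∩-─ []            []            f = refl
  sumOver-∩-─ (inside  ∷ p) (inside  ∷ q) f =
    trans (cong (f zero +_) (sumOver-∩-─ p q (f ∘ suc))) (sym (+-assoc (f zero) _ _))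
  sumOver-∩-─ (inside  ∷ p) (outside ∷ q) f =
    trans (cong (f zero +_) (sumOver-∩-─ p q (f ∘ suc)))
          (x∙yz≈y∙xz (f zero) (sumOver (p ∩ q) (f ∘ suc)) (sumOver (p ─ q) (f ∘ suc)))
  sumOver-∩-─ (outside ∷ p) (inside  ∷ q) f = sumOver-∩-─ p q (f ∘ suc)
  sumOver-∩-─ (outside ∷ p) (outside ∷ q) f = sumOver-∩-─ p q (f ∘ suc)

  sumOver-∪ : ∀ {n} (p q : Subset n) (f : Fin n → ℚ) →
              sumOver (p ∪ q) f ≡ sumOver p f + sumOver (q ─ p) f
  sumOver-∪ []            []            f = refl
  sumOver-∪ (inside  ∷ p) (_       ∷ q) f =
    trans (cong (f zero +_) (sumOver-∪ p q (f ∘ suc))) (sym (+-assoc (f zero) _ _))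
  sumOver-∪ (outside ∷ p) (inside  ∷ q) f =
    trans (cong (f zero +_) (sumOver-∪ p q (f ∘ suc)))
          (x∙yz≈y∙xz (f zero) (sumOver p (f ∘ suc)) (sumOver (q ─ p) (f ∘ suc)))
  sumOver-∪ (outside ∷ p) (outside ∷ q) f = sumOver-∪ p q (f ∘ suc)

  ÷₀-*-cancel : ∀ p c → (c ≡ 0ℚ → p ≡ 0ℚ) → (p ÷₀ c) * c ≡ p
  ÷₀-*-cancel p c c≡0⇒p≡0 with c ≟ 0ℚ
  ... | yes c≡0 = trans (*-zeroˡ c) (sym (c≡0⇒p≡0 c≡0))
  ... | no  c≢0 = begin
    p * (1/ c) * c    ≡⟨ *-assoc p _ c ⟩
    p * ((1/ c) * c)  ≡⟨ cong (p *_) (*-inverseˡ c) ⟩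
    p * 1ℚ            ≡⟨ *-identityʳ p ⟩
    p                 ∎
    where open ≡-Reasoning
          instance _ = ≢-nonZero c≢0

  private
    <⇒≱ : ∀ {p q : ℚ} → p < q → ¬ (q ≤ p)
    <⇒≱ p<q q≤p = <-irrefl refl (<-≤-trans p<q q≤p)

    ≤∧≢⇒< : ∀ {p q : ℚ} → p ≤ q → p ≢ q → p < q
    ≤∧≢⇒< {p} {q} p≤q p≢q with p <? q
    ... | yes p<q = p<q
    ... | no  p≮q = contradiction (≤-antisym p≤q (≮⇒≥ p≮q)) p≢q

    x+y≡u+v∧x<u⇒v<y : ∀ {x y u v : ℚ} → x + y ≡ u + v → x < u → v < y
    x+y≡u+v∧x<u⇒v<y {x} {y} {u} {v} eq x<u with v <? y
    ... | yes v<y = v<y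
    ... | no  v≮y = contradiction eq (<⇒≢ (+-mono-<-≤ x<u (≮⇒≥ v≮y)))

    x+y≡u+v∧y<v⇒u<x : ∀ {x y u v : ℚ} → x + y ≡ u + v → y < v → u < x
    x+y≡u+v∧y<v⇒u<x {x} {y} {u} {v} eq =
      x+y≡u+v∧x<u⇒v<y (trans (+-comm y x) (trans eq (+-comm u v)))

    +-cancelˡ-≤ : ∀ x {y z : ℚ} → x + y ≤ x + z → y ≤ z
    +-cancelˡ-≤ x {y} {z} x+y≤x+z with z <? y
    ... | yes z<y = contradiction x+y≤x+z (<⇒≱ (+-monoʳ-< x z<y))
    ... | no  z≮y = ≮⇒≥ z≮y

  module _ {n} (G : Tree n) where

    prizeC≡lowerPrize : ∀ S → prizeC G S ≡ lowerPrize G S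
    prizeC≡lowerPrize S = +-identityˡ (lowerPrize G S)

    densityC≡dG : ∀ S → densityC G S ≡ dG G S
    densityC≡dG S = cong (_÷₀ costOf G S) (prizeC≡lowerPrize S)

    prizeC-∩-─ : ∀ S Q → prizeC G S ≡ prizeC G (S ∩ Q) + prizeC G (S ─ Q)
    prizeC-∩-─ S Q = begin
      prizeC G S                                   ≡⟨ prizeC≡lowerPrize S ⟩
      lowerPrize G S                               ≡⟨ sumOver-∩-─ S Q _ ⟩
      lowerPrize G (S ∩ Q) + lowerPrize G (S ─ Q)
        ≡⟨ cong₂ _+_ (prizeC≡lowerPrize (S ∩ Q)) (prizeC≡lowerPrize (S ─ Q)) ⟨
      prizeC G (S ∩ Q) + prizeC G (S ─ Q)          ∎
      where open ≡-Reasoning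

    prizeC-∪ : ∀ S Q → prizeC G (S ∪ Q) ≡ prizeC G S + prizeC G (Q ─ S)
    prizeC-∪ S Q = begin
      prizeC G (S ∪ Q)                         ≡⟨ prizeC≡lowerPrize (S ∪ Q) ⟩
      lowerPrize G (S ∪ Q)                     ≡⟨ sumOver-∪ S Q _ ⟩
      lowerPrize G S + lowerPrize G (Q ─ S)
        ≡⟨ cong₂ _+_ (prizeC≡lowerPrize S) (prizeC≡lowerPrize (Q ─ S)) ⟨
      prizeC G S + prizeC G (Q ─ S)            ∎
      where open ≡-Reasoning

    costOf-nonneg : ∀ S → 0ℚ ≤ costOf G S
    costOf-nonneg S = sumOver-nonneg S (<⇒≤ ∘ cost-pos G)

    costOf-pos : ∀ {S} → Nonempty S → 0ℚ < costOf G S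
    costOf-pos {S} = sumOver-pos S (cost-pos G)

    prizeC≤totalPrizeC : ∀ {T̄ S} → RootedSubtreeC G T̄ S → prizeC G S ≤ totalPrizeC G T̄
    prizeC≤totalPrizeC (S∌ , _) =
      +-monoʳ-≤ 0ℚ (sumOver-mono (prize-nn G ∘ suc) (x∉p⇒x∈∁p ∘ S∌ _))

    costOf≡0⇒prizeC≡0 : ∀ S → costOf G S ≡ 0ℚ → prizeC G S ≡ 0ℚ
    costOf≡0⇒prizeC≡0 S c≡0 with nonempty? S
    ... | yes S≠∅ = contradiction c≡0 (≢-sym (<⇒≢ (costOf-pos S≠∅)))
    ... | no  S=∅ = begin
      prizeC G S      ≡⟨ prizeC≡lowerPrize S ⟩
      lowerPrize G S  ≡⟨ cong (lowerPrize G) (Empty-unique S=∅) ⟩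
      lowerPrize G ∅  ≡⟨ sumOver-⊥ (prize G ∘ suc) ⟩
      0ℚ              ∎
      where open ≡-Reasoning

    prizeC≡densityC*costOf : ∀ S → prizeC G S ≡ densityC G S * costOf G S
    prizeC≡densityC*costOf S = sym (÷₀-*-cancel (prizeC G S) (costOf G S) (costOf≡0⇒prizeC≡0 S))

    densityC≤⇒prizeC≤ : ∀ {δ} S → densityC G S ≤ δ → prizeC G S ≤ δ * costOf G S
    densityC≤⇒prizeC≤ {δ} S d≤δ = subst (_≤ δ * costOf G S) (sym (prizeC≡densityC*costOf S))
      (*-monoʳ-≤-nonNeg (costOf G S) {{nonNegative (costOf-nonneg S)}} d≤δ)

    densityC<⇒prizeC< : ∀ {δ} S → Nonempty S → densityC G S < δ → prizeC G S < δ * costOf G S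
    densityC<⇒prizeC< {δ} S S≠∅ d<δ = subst (_< δ * costOf G S) (sym (prizeC≡densityC*costOf S))
      (*-monoˡ-<-pos (costOf G S) {{positive (costOf-pos S≠∅)}} d<δ)

    prizeC>⇒densityC> : ∀ {δ} S → δ * costOf G S < prizeC G S → δ < densityC G S
    prizeC>⇒densityC> {δ} S δc<p = *-cancelʳ-<-nonNeg (costOf G S) {{nonNegative (costOf-nonneg S)}}
      (subst (δ * costOf G S <_) (prizeC≡densityC*costOf S) δc<p)

    densityC-nonneg : ∀ {S} → Nonempty S → 0ℚ ≤ densityC G S
    densityC-nonneg {S} S≠∅ = *-cancelʳ-≤-pos (costOf G S) {{positive (costOf-pos S≠∅)}}
      (subst₂ _≤_ (sym (*-zeroˡ (costOf G S))) (prizeC≡densityC*costOf S)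
        (+-monoʳ-≤ 0ℚ (sumOver-nonneg S (prize-nn G ∘ suc))))

    balanced-∩-─ : ∀ δ S Q → prizeC G S ≡ δ * costOf G S →
      prizeC G (S ∩ Q) + prizeC G (S ─ Q) ≡ δ * costOf G (S ∩ Q) + δ * costOf G (S ─ Q)
    balanced-∩-─ δ S Q balanced = begin
      prizeC G (S ∩ Q) + prizeC G (S ─ Q)            ≡⟨ prizeC-∩-─ S Q ⟨
      prizeC G S                                     ≡⟨ balanced ⟩
      δ * costOf G S                                 ≡⟨ cong (δ *_) (sumOver-∩-─ S Q (cost G)) ⟩
      δ * (costOf G (S ∩ Q) + costOf G (S ─ Q))      ≡⟨ *-distribˡ-+ δ _ _ ⟩
      δ * costOf G (S ∩ Q) + δ * costOf G (S ─ Q)    ∎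
      where open ≡-Reasoning

    sparse-∪ : ∀ δ S Q → prizeC G S ≡ δ * costOf G S → prizeC G (S ∪ Q) ≤ δ * costOf G (S ∪ Q) →
               prizeC G (Q ─ S) ≤ δ * costOf G (Q ─ S)
    sparse-∪ δ S Q balanced sparse = +-cancelˡ-≤ (prizeC G S) (begin
      prizeC G S + prizeC G (Q ─ S)                   ≡⟨ prizeC-∪ S Q ⟨
      prizeC G (S ∪ Q)                                ≤⟨ sparse ⟩
      δ * costOf G (S ∪ Q)                            ≡⟨ cong (δ *_) (sumOver-∪ S Q (cost G)) ⟩
      δ * (costOf G S + costOf G (Q ─ S))             ≡⟨ *-distribˡ-+ δ _ _ ⟩
      δ * costOf G S + δ * costOf G (Q ─ S)           ≡⟨ cong (_+ δ * costOf G (Q ─ S)) balanced ⟨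
      prizeC G S + δ * costOf G (Q ─ S)               ∎)
      where open ≤-Reasoning

    module Nesting {T̄ T̄′ T* y} (T*-minmax : MinMax G T̄ T*)
                   (T̄⊆T̄′ : T̄ ⊆ T̄′) (T̄′⊆T̄∪T* : T̄′ ⊆ T̄ ∪ T*)
                   (T̄′-rooted : RootedSubtree G T̄′)
                   (shared : Nonempty (T* ∩ T̄′)) (y-missing : y ∈ T* ─ T̄′) where

      d* : ℚ
      d* = densityC G T*

      T*-rooted : RootedSubtreeC G T̄ T*
      T*-rooted = proj₁ T*-minmax

      T*-max : ∀ S → RootedSubtreeC G T̄ S → densityC G S ≤ d*
      T*-max = proj₁ (proj₂ T*-minmax)

      T*-min : ∀ S → RootedSubtreeC G T̄ S → S ⊆ T* → densityC G S ≡ d* → S ≡ T*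
      T*-min = proj₂ (proj₂ T*-minmax)

      T*-balanced : prizeC G T* ≡ d* * costOf G T*
      T*-balanced = prizeC≡densityC*costOf T*

      overlap-rooted : RootedSubtreeC G T̄ (T* ∩ T̄′)
      overlap-rooted = ∩-rootedSubtreeC G T*-rooted T̄′-rooted

      overlap-sparser : densityC G (T* ∩ T̄′) < d*
      overlap-sparser = ≤∧≢⇒< (T*-max _ overlap-rooted) overlap-density≢d*
        where
        overlap-density≢d* : densityC G (T* ∩ T̄′) ≢ d*
        overlap-density≢d* same-density = x∈p─q⇒x∉q y-missing (proj₂ (x∈p∩q⁻ T* T̄′ y∈T*∩T̄′))
          where
          y∈T*∩T̄′ : y ∈ T* ∩ T̄′
          y∈T*∩T̄′ = subst (y ∈_) (sym (T*-min _ overlap-rooted (p∩q⊆p T* T̄′) same-density))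
                          (p─q⊆p T* T̄′ y-missing)

      remainder-rooted : RootedSubtreeC G T̄′ (T* ─ T̄′)
      remainder-rooted = ─-rootedSubtreeC G T̄⊆T̄′ T*-rooted

      remainder-dense : d* * costOf G (T* ─ T̄′) < prizeC G (T* ─ T̄′)
      remainder-dense = x+y≡u+v∧x<u⇒v<y (balanced-∩-─ d* T* T̄′ T*-balanced)
                                         (densityC<⇒prizeC< (T* ∩ T̄′) shared overlap-sparser)

      totalPrizeC-pos : 0ℚ < totalPrizeC G T̄′
      totalPrizeC-pos = begin-strict
        0ℚ                        ≡⟨ *-zeroˡ (costOf G (T* ─ T̄′)) ⟨
        0ℚ * costOf G (T* ─ T̄′)  ≤⟨ *-monoʳ-≤-nonNeg _ {{remainder-cost≥0}} d*≥0 ⟩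
        d* * costOf G (T* ─ T̄′)  <⟨ remainder-dense ⟩
        prizeC G (T* ─ T̄′)       ≤⟨ prizeC≤totalPrizeC remainder-rooted ⟩
        totalPrizeC G T̄′         ∎
        where
        open ≤-Reasoning
        d*≥0 : 0ℚ ≤ d*
        d*≥0 = densityC-nonneg (proj₁ shared , p∩q⊆p T* T̄′ (proj₂ shared))
        remainder-cost≥0 : NonNegative (costOf G (T* ─ T̄′))
        remainder-cost≥0 = nonNegative (costOf-nonneg (T* ─ T̄′))

      module _ {S} (S-minmax : MinMax G T̄′ S) where

        S-max : ∀ R → RootedSubtreeC G T̄′ R → densityC G R ≤ densityC G S
        S-max = proj₁ (proj₂ S-minmax)

        minmax-denser : d* < densityC G S
        minmax-denser = <-≤-trans (prizeC>⇒densityC> (T* ─ T̄′) remainder-dense)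
                                  (S-max _ remainder-rooted)

        minmax-⊆ : S ⊆ T*
        minmax-⊆ {x} x∈S with x ∈? T*
        ... | yes x∈T* = x∈T*
        ... | no  x∉T* = contradiction (S-max _ inside-rooted) (<⇒≱ inside-denser)
          where
          inside-rooted : RootedSubtreeC G T̄′ (S ∩ T*)
          inside-rooted = ∩-rootedSubtreeC-⊆ G T̄⊆T̄′ (proj₁ S-minmax) T*-rooted
          union-rooted : RootedSubtreeC G T̄ (T* ∪ S)
          union-rooted = ∪-rootedSubtreeC G T̄⊆T̄′ T̄′⊆T̄∪T* T*-rooted (proj₁ S-minmax)
          outside-sparse : prizeC G (S ─ T*) ≤ d* * costOf G (S ─ T*)
          outside-sparse = sparse-∪ d* T* S T*-balanced
                             (densityC≤⇒prizeC≤ (T* ∪ S) (T*-max _ union-rooted))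
          outside-sparser : prizeC G (S ─ T*) < densityC G S * costOf G (S ─ T*)
          outside-sparser = ≤-<-trans outside-sparse
            (*-monoˡ-<-pos _ {{positive (costOf-pos (x , x∈p∧x∉q⇒x∈p─q x∈S x∉T*))}} minmax-denser)
          inside-denser : densityC G S < densityC G (S ∩ T*)
          inside-denser = prizeC>⇒densityC> (S ∩ T*)
            (x+y≡u+v∧y<v⇒u<x (balanced-∩-─ (densityC G S) S T* (prizeC≡densityC*costOf S))
                              outside-sparser)

open import Data.Nat using (_+_; _<_; _≤_; z≤n; s≤s)
open import Data.Nat.Properties
  using ( ≤-refl; <⇒≤; <⇒≢; ≤-<-trans; ≤∧≢⇒<; n<1+n; m<n⇒m<1+n; m<1+n⇒m<n∨m≡n; n≢0⇒n>0
        ; +-suc; +-identityʳ; +-cancelʳ-≡ )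
open import Data.Rational using (0ℚ) renaming (_<_ to _<ℚ_)
import Data.Rational.Properties as ℚ

0<∣p∣⇒Nonempty : ∀ {n} {p : Subset n} → 0 < ∣ p ∣ → Nonempty p
0<∣p∣⇒Nonempty {n} {p} 0<∣p∣ with nonempty? p
... | yes p≠∅ = p≠∅
... | no  p=∅ = contradiction (sym (trans (cong ∣_∣ (Empty-unique p=∅)) (∣⊥∣≡0 n))) (<⇒≢ 0<∣p∣)

module _ {n} {G : Tree n} {m} (X : Execution G m) where

  Appended : ℕ → ℕ → Fin n → Set
  Appended k i x = Σ ℕ λ j → j < i × e X (k + j) ≡ x

  Appended-suc : ∀ {k i x} → Appended k (suc i) x → Appended k i x ⊎ e X (k + i) ≡ x
  Appended-suc (j , j<1+i , eⱼ≡x) with m<1+n⇒m<n∨m≡n j<1+i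
  ... | inj₁ j<i  = inj₁ (j , j<i , eⱼ≡x)
  ... | inj₂ refl = inj₂ eⱼ≡x

  Tbar-suc⁻ : ∀ {t x} → t < m → x ∈ Tbar X (suc t) → x ∈ Tbar X t ⊎ e X t ≡ x
  Tbar-suc⁻ {t} t<m x∈ =
    map₂ (sym ∘ x∈⁅y⁆⇒x≡y (e X t)) (x∈p∪q⁻ (Tbar X t) ⁅ e X t ⁆ (subst (_ ∈_) (step X t t<m) x∈))

  Tbar-suc⁺ : ∀ {t x} → t < m → x ∈ Tbar X t ⊎ e X t ≡ x → x ∈ Tbar X (suc t)
  Tbar-suc⁺ {t} t<m x∈ =
    subst (_ ∈_) (sym (step X t t<m)) (x∈p∪q⁺ (map₂ (λ { refl → x∈⁅x⁆ (e X t) }) x∈))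

  e∉Tbar : ∀ {t} → t < m → e X t ∉ Tbar X t
  e∉Tbar {t} t<m = proj₁ (proj₁ (minmax X t t<m)) (e X t) (proj₁ (rootEdge X t t<m))

  Tbar-rooted : ∀ {t} → t ≤ m → RootedSubtree G (Tbar X t)
  Tbar-rooted {zero}  _   i j i∈ _ = contradiction (subst (i ∈_) (start X) i∈) ∉⊥
  Tbar-rooted {suc t} t<m i j i∈ i→j with Tbar-suc⁻ t<m i∈
  ... | inj₁ i∈Tbar = Tbar-suc⁺ t<m (inj₁ (Tbar-rooted (<⇒≤ t<m) i j i∈Tbar i→j))
  ... | inj₂ refl with proj₂ (rootEdge X t t<m)
  ...   | inj₁ e→r = contradiction (trans (sym e→r) i→j) 0≢1+n
  ...   | inj₂ (j′ , e→j′ , j′∈Tbar) with suc-injective (trans (sym i→j) e→j′)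
  ...     | refl = Tbar-suc⁺ t<m (inj₁ j′∈Tbar)

  totalPrizeC-pos⇒<m : ∀ {t} → t ≤ m → 0ℚ <ℚ totalPrizeC G (Tbar X t) → t < m
  totalPrizeC-pos⇒<m t≤m prize>0 = ≤∧≢⇒< t≤m λ { refl → ℚ.<⇒≢ prize>0 (sym (stop X)) }

  Tbar-+⁻ : ∀ {k i x} → k + i ≤ m → x ∈ Tbar X (k + i) → x ∈ Tbar X k ⊎ Appended k i x
  Tbar-+⁻ {k} {zero} {x} _ x∈ = inj₁ (subst (λ t → x ∈ Tbar X t) (+-identityʳ k) x∈)
  Tbar-+⁻ {k} {suc i} k+i<m x∈ rewrite +-suc k i with Tbar-suc⁻ k+i<m x∈
  ... | inj₁ x∈Tbar =
    map₂ (λ (j , j<i , eⱼ≡x) → j , m<n⇒m<1+n j<i , eⱼ≡x) (Tbar-+⁻ (<⇒≤ k+i<m) x∈Tbar)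
  ... | inj₂ eᵢ≡x   = inj₂ (i , n<1+n i , eᵢ≡x)

  Tbar-+⁺ : ∀ {k i x} → k + i ≤ m → x ∈ Tbar X k ⊎ Appended k i x → x ∈ Tbar X (k + i)
  Tbar-+⁺ {k} {zero} {x} _ (inj₁ x∈) = subst (λ t → x ∈ Tbar X t) (sym (+-identityʳ k)) x∈
  Tbar-+⁺ {k} {suc i} k+i<m (inj₁ x∈Tbar) rewrite +-suc k i =
    Tbar-suc⁺ k+i<m (inj₁ (Tbar-+⁺ (<⇒≤ k+i<m) (inj₁ x∈Tbar)))
  Tbar-+⁺ {k} {suc i} k+i<m (inj₂ x-appended) rewrite +-suc k i =
    Tbar-suc⁺ k+i<m (map₁ (Tbar-+⁺ (<⇒≤ k+i<m) ∘ inj₂) (Appended-suc x-appended))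

module Iteration {n} {G : Tree n} {m} (X : Execution G m) (k : ℕ) (k<m : k < m) where

  T* : Subset n
  T* = chosen X k

  ℓ : ℕ
  ℓ = ∣ T* ∣

  T*-minmax : MinMax G (Tbar X k) T*
  T*-minmax = minmax X k k<m

  T*∌ : ∀ x → x ∈ T* → x ∉ Tbar X k
  T*∌ = proj₁ (proj₁ T*-minmax)

  eₖ∈T* : e X k ∈ T*
  eₖ∈T* = proj₁ (rootEdge X k k<m)

  record Progress (i : ℕ) : Set where
    field
      within    : k + i ≤ m
      appended⊆ : ∀ {x} → Appended X k i x → x ∈ T*
      remaining : ∣ T* ─ Tbar X (k + i) ∣ + i ≡ ℓ

  open Progress public

  module Later {i} (1≤i : 1 ≤ i) (i<ℓ : i < ℓ) (p : Progress i) where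

    Tbarₖ⊆Tbar : Tbar X k ⊆ Tbar X (k + i)
    Tbarₖ⊆Tbar = Tbar-+⁺ X (within p) ∘ inj₁

    Tbar⊆Tbarₖ∪T* : Tbar X (k + i) ⊆ Tbar X k ∪ T*
    Tbar⊆Tbarₖ∪T* = x∈p∪q⁺ ∘ map₂ (appended⊆ p) ∘ Tbar-+⁻ X (within p)

    eₖ-shared : Nonempty (T* ∩ Tbar X (k + i))
    eₖ-shared = e X k , x∈p∩q⁺ (eₖ∈T* , Tbar-+⁺ X (within p) (inj₂ eₖ-appended))
      where
      eₖ-appended : Appended X k i (e X k)
      eₖ-appended = 0 , 1≤i , cong (e X) (+-identityʳ k)

    T*-unfinished : Nonempty (T* ─ Tbar X (k + i))
    T*-unfinished = 0<∣p∣⇒Nonempty (n≢0⇒n>0 something-remains)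
      where
      something-remains : ∣ T* ─ Tbar X (k + i) ∣ ≢ 0
      something-remains nothing-remains =
        <⇒≢ i<ℓ (trans (cong (_+ i) (sym nothing-remains)) (remaining p))

    open Nesting G T*-minmax Tbarₖ⊆Tbar Tbar⊆Tbarₖ∪T* (Tbar-rooted X (within p)) eₖ-shared
                 (proj₂ T*-unfinished)

    k+i<m : k + i < m
    k+i<m = totalPrizeC-pos⇒<m X (within p) totalPrizeC-pos

    chosen⊆T* : chosen X (k + i) ⊆ T*
    chosen⊆T* = minmax-⊆ (minmax X (k + i) k+i<m)

    chosen-denser : densityC G T* <ℚ densityC G (chosen X (k + i))
    chosen-denser = minmax-denser (minmax X (k + i) k+i<m)

  next-edge : ∀ i → i < ℓ → Progress i → k + i < m × e X (k + i) ∈ T*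
  next-edge zero    _   _ rewrite +-identityʳ k = k<m , eₖ∈T*
  next-edge (suc i) i<ℓ p = k+i<m , chosen⊆T* (proj₁ (rootEdge X (k + suc i) k+i<m))
    where open Later (s≤s z≤n) i<ℓ p

  progress-zero : Progress 0
  progress-zero = record
    { within    = subst (_≤ m) (sym (+-identityʳ k)) (<⇒≤ k<m)
    ; appended⊆ = λ { (_ , () , _) }
    ; remaining = trans (+-identityʳ _)
                    (cong ∣_∣ (trans (cong (λ t → T* ─ Tbar X t) (+-identityʳ k)) (p─q≡p T*∌)))
    }

  progress-suc : ∀ i → i < ℓ → Progress i → Progress (suc i)
  progress-suc i i<ℓ p = record
    { within    = subst (_≤ m) (sym (+-suc k i)) k+i<m
    ; appended⊆ = λ x-appended → [ appended⊆ p , (λ { refl → eᵢ∈T* }) ]′ (Appended-suc X x-appended)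
    ; remaining = begin
        ∣ T* ─ Tbar X (k + suc i) ∣ + suc i
          ≡⟨ +-suc _ i ⟩
        suc ∣ T* ─ Tbar X (k + suc i) ∣ + i
          ≡⟨ cong (λ R → suc ∣ R ∣ + i) T*─Tbar-suc ⟩
        suc ∣ (T* ─ Tbar X (k + i)) - e X (k + i) ∣ + i
          ≡⟨ cong (_+ i) (x∈p⇒suc∣p-x∣≡∣p∣ eᵢ-remains) ⟩
        ∣ T* ─ Tbar X (k + i) ∣ + i
          ≡⟨ remaining p ⟩
        ℓ ∎
    }
    where
    open ≡-Reasoning
    k+i<m = proj₁ (next-edge i i<ℓ p)
    eᵢ∈T* = proj₂ (next-edge i i<ℓ p)
    eᵢ-remains : e X (k + i) ∈ T* ─ Tbar X (k + i)
    eᵢ-remains = x∈p∧x∉q⇒x∈p─q eᵢ∈T* (e∉Tbar X k+i<m)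
    T*─Tbar-suc : T* ─ Tbar X (k + suc i) ≡ (T* ─ Tbar X (k + i)) - e X (k + i)
    T*─Tbar-suc = begin
      T* ─ Tbar X (k + suc i)                   ≡⟨ cong (λ t → T* ─ Tbar X t) (+-suc k i) ⟩
      T* ─ Tbar X (suc (k + i))                 ≡⟨ cong (T* ─_) (step X (k + i) k+i<m) ⟩
      T* ─ (Tbar X (k + i) ∪ ⁅ e X (k + i) ⁆)   ≡⟨ p─q─r≡p─q∪r T* _ _ ⟨
      (T* ─ Tbar X (k + i)) - e X (k + i)       ∎

  progress : ∀ i → i ≤ ℓ → Progress i
  progress zero    _   = progress-zero
  progress (suc i) i<ℓ = progress-suc i i<ℓ (progress i (<⇒≤ i<ℓ))

  final : Progress ℓ
  final = progress ℓ ≤-refl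

  later-chosen : ∀ i → 1 ≤ i → i < ℓ → chosen X (k + i) ⊆ T* × dG G T* <ℚ dG G (chosen X (k + i))
  later-chosen i 1≤i i<ℓ =
    chosen⊆T* , subst₂ _<ℚ_ (densityC≡dG G T*) (densityC≡dG G (chosen X (k + i))) chosen-denser
    where open Later 1≤i i<ℓ (progress i (<⇒≤ i<ℓ))

  T*⊆Tbar : T* ⊆ Tbar X (k + ℓ)
  T*⊆Tbar {x} x∈T* with x ∈? Tbar X (k + ℓ)
  ... | yes x∈Tbar = x∈Tbar
  ... | no  x∉Tbar = contradiction nothing-remains (≢-sym (<⇒≢ something-remains))
    where
    x-remains : x ∈ T* ─ Tbar X (k + ℓ)
    x-remains = x∈p∧x∉q⇒x∈p─q x∈T* x∉Tbar
    something-remains : 0 < ∣ T* ─ Tbar X (k + ℓ) ∣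
    something-remains = ≤-<-trans z≤n (x∈p⇒∣p-x∣<∣p∣ x-remains)
    nothing-remains : ∣ T* ─ Tbar X (k + ℓ) ∣ ≡ 0
    nothing-remains = +-cancelʳ-≡ ℓ _ 0 (remaining final)

  covered : ∀ x → x ∈ T* → Appended X k ℓ x
  covered x x∈T* with Tbar-+⁻ X (within final) (T*⊆Tbar x∈T*)
  ... | inj₁ x∈Tbarₖ   = contradiction x∈Tbarₖ (T*∌ x x∈T*)
  ... | inj₂ x-appended = x-appended

lemma9 : ∀ {n} (G : Tree n) → prize G zero ≡ 0ℚ →
    ∀ {m} (X : Execution G m) (k : ℕ) → k < m →
    (k + ∣ chosen X k ∣ ≤ m) ×
    (∀ i → 1 ≤ i → i < ∣ chosen X k ∣ →
      (chosen X (k + i) ⊆ chosen X k) × (dG G (chosen X k) <ℚ dG G (chosen X (k + i)))) ×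
    (∀ x → (x ∈ chosen X k → Σ ℕ (λ i → i < ∣ chosen X k ∣ × e X (k + i) ≡ x)) ×
           (Σ ℕ (λ i → i < ∣ chosen X k ∣ × e X (k + i) ≡ x) → x ∈ chosen X k))
lemma9 G _ X k k<m = within final , later-chosen , λ x → covered x , appended⊆ final
  where open Iteration X k k<m
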